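{- Let $f(X)=X^3+c_2X^2+c_1X+c_0\in\mathbb{Z}[X]$ be irreducible, with root $r$. For indeterminates $a_0,a_1,a_2$, let $M_\alpha$, $N(\alpha)=\det M_\alpha$ and the cofactors $B_{ij}$ be the polynomials in $a_0,a_1,a_2$ defined below. Then there is a homogeneous polynomial $q_0=q_0(a_1,a_2)$ in $a_1,a_2$ alone (not involving $a_0$) such that $$B_{23}B_{11}-B_{13}B_{21}=q_0\,N(\alpha)$$ identically.
   Context: For $\alpha=a_0+a_1r+a_2r^2$, $M_\alpha$ is the matrix of multiplication by $\alpha$ in the basis $\{1,r,r^2\}$: $$M_\alpha=\begin{pmatrix} a_0 & -c_0a_2 & a_2c_0c_2 - a_1c_0\\ a_1 & a_0-c_1a_2 & a_2c_1c_2 - a_2c_0 - a_1c_1\\ a_2 & a_1-c_2a_2 & a_2c_2^2 - a_2c_1 - a_1c_2 + a_0 \end{pmatrix}.$$ $B_{ij}$ is $(-1)^{i+j}$ times the determinant of the matrix obtained from $M_\alpha$ by deleting row $i$ and column $j$. -}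

module Defs where

open import Data.Nat as ℕ using (ℕ; zero; suc; _∸_)
open import Data.Integer using (ℤ; +_; -_; _+_; _-_; _*_; _^_)
open import Data.Fin using (Fin; zero; suc; toℕ; punchIn)
open import Data.List using (List; []; _∷_)
open import Data.Product using (_×_)
open import Data.Sum using (_⊎_)
open import Relation.Binary.PropositionalEquality using (_≡_)
open import Relation.Nullary using (¬_)

-- Univariate polynomials over ℤ as coefficient lists (constant term first)

Poly : Set
Poly = List ℤ

coeff : Poly → ℕ → ℤ
coeff []       _       = + 0
coeff (a ∷ p)  zero    = a
coeff (a ∷ p)  (suc n) = coeff p n

sumTo : ℕ → (ℕ → ℤ) → ℤ
sumTo zero    f = f 0
sumTo (suc n) f = sumTo n f + f (suc n)

coeffMul : Poly → Poly → ℕ → ℤ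
coeffMul g h n = sumTo n (λ i → coeff g i * coeff h (n ∸ i))

_≈P_ : Poly → Poly → Set
p ≈P q = ∀ n → coeff p n ≡ coeff q n

IsUnit : Poly → Set
IsUnit g = ((coeff g 0 ≡ + 1) ⊎ (coeff g 0 ≡ - + 1)) × (∀ n → coeff g (suc n) ≡ + 0)

Irreducible : Poly → Set
Irreducible f =
  ¬ (∀ n → coeff f n ≡ + 0) × ¬ IsUnit f ×
  (∀ g h → (∀ n → coeff f n ≡ coeffMul g h n) → IsUnit g ⊎ IsUnit h)

cubic : ℤ → ℤ → ℤ → Poly
cubic c0 c1 c2 = c0 ∷ c1 ∷ c2 ∷ + 1 ∷ []

-- The matrix M_α (rows/columns indexed 0,1,2 for the paper's 1,2,3)

Mat3 : Set
Mat3 = Fin 3 → Fin 3 → ℤ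

Mα : (c0 c1 c2 a0 a1 a2 : ℤ) → Mat3
Mα c0 c1 c2 a0 a1 a2 zero          zero          = a0
Mα c0 c1 c2 a0 a1 a2 zero          (suc zero)    = - (c0 * a2)
Mα c0 c1 c2 a0 a1 a2 zero          (suc (suc _)) = a2 * c0 * c2 - a1 * c0
Mα c0 c1 c2 a0 a1 a2 (suc zero)    zero          = a1
Mα c0 c1 c2 a0 a1 a2 (suc zero)    (suc zero)    = a0 - c1 * a2
Mα c0 c1 c2 a0 a1 a2 (suc zero)    (suc (suc _)) = a2 * c1 * c2 - a2 * c0 - a1 * c1
Mα c0 c1 c2 a0 a1 a2 (suc (suc _)) zero          = a2
Mα c0 c1 c2 a0 a1 a2 (suc (suc _)) (suc zero)    = a1 - c2 * a2
Mα c0 c1 c2 a0 a1 a2 (suc (suc _)) (suc (suc _)) = a2 * c2 ^ 2 - a2 * c1 - a1 * c2 + a0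

det2 : (Fin 2 → Fin 2 → ℤ) → ℤ
det2 m = m zero zero * m (suc zero) (suc zero) - m zero (suc zero) * m (suc zero) zero

det3 : Mat3 → ℤ
det3 m =
    m i0 i0 * m i1 i1 * m i2 i2 + m i0 i1 * m i1 i2 * m i2 i0 + m i0 i2 * m i1 i0 * m i2 i1
  - m i0 i2 * m i1 i1 * m i2 i0 - m i0 i0 * m i1 i2 * m i2 i1 - m i0 i1 * m i1 i0 * m i2 i2
  where
  i0 i1 i2 : Fin 3
  i0 = zero
  i1 = suc zero
  i2 = suc (suc zero)

minor : Mat3 → Fin 3 → Fin 3 → (Fin 2 → Fin 2 → ℤ)
minor m i j k l = m (punchIn i k) (punchIn j l)

cofactor : Mat3 → Fin 3 → Fin 3 → ℤ
cofactor m i j = (- + 1) ^ (toℕ i ℕ.+ toℕ j) * det2 (minor m i j)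

homog : (d : ℕ) → (ℕ → ℤ) → ℤ → ℤ → ℤ
homog d q a1 a2 = sumTo d (λ k → q k * a1 ^ k * a2 ^ (d ∸ k))

-- The cofactors of M_α are the entries of adj M_α, and Jacobi's complementary
-- minor theorem says that a 2 × 2 minor of the adjugate of a 3 × 3 matrix is
-- det M times the complementary entry of M, up to sign.  The minor in question
-- is complementary to the entry (3,2) of M_α, namely a₁ − c₂a₂, so
-- q₀ = c₂a₂ − a₁ works.
module Submission where

open import Defs
open import Data.Nat using (ℕ)
open import Data.Integer using (ℤ; +_; -_; _+_; _-_; _*_; _^_)
open import Data.Integer.Tactic.RingSolver using (solve-∀)
open import Data.Fin using (Fin; zero; suc)
open import Data.Product using (Σ; _,_)
open import Relation.Binary.PropositionalEquality using (_≡_; cong; module ≡-Reasoning)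

i0 i1 i2 : Fin 3
i0 = zero
i1 = suc zero
i2 = suc (suc zero)

-- Both sides are written exactly as cofactor and det3 unfold on a matrix
-- with entries mᵢⱼ, so that this instantiates to every Mat3 by conversion.
adjugate-minor-entries : ∀ m₀₀ m₀₁ m₀₂ m₁₀ m₁₁ m₁₂ m₂₀ m₂₁ m₂₂ →
  (- + 1) ^ 3 * (m₀₀ * m₂₁ - m₀₁ * m₂₀) * ((- + 1) ^ 0 * (m₁₁ * m₂₂ - m₁₂ * m₂₁))
    - (- + 1) ^ 2 * (m₁₀ * m₂₁ - m₁₁ * m₂₀) * ((- + 1) ^ 1 * (m₀₁ * m₂₂ - m₀₂ * m₂₁))
  ≡ - m₂₁ * ( m₀₀ * m₁₁ * m₂₂ + m₀₁ * m₁₂ * m₂₀ + m₀₂ * m₁₀ * m₂₁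
            - m₀₂ * m₁₁ * m₂₀ - m₀₀ * m₁₂ * m₂₁ - m₀₁ * m₁₀ * m₂₂)
adjugate-minor-entries = solve-∀

adjugate-minor : ∀ (m : Mat3) →
  cofactor m i1 i2 * cofactor m i0 i0 - cofactor m i0 i2 * cofactor m i1 i0
    ≡ - m i2 i1 * det3 m
adjugate-minor m = adjugate-minor-entries
  (m i0 i0) (m i0 i1) (m i0 i2) (m i1 i0) (m i1 i1) (m i1 i2) (m i2 i0) (m i2 i1) (m i2 i2)

linearForm : ℤ → ℤ → ℕ → ℤ
linearForm u v 0 = u
linearForm u v _ = v

homog-linearForm : ∀ u v a₁ a₂ → homog 1 (linearForm u v) a₁ a₂ ≡ u * a₂ + v * a₁
homog-linearForm = unfolded
  where
  unfolded : ∀ u v a₁ a₂ → u * + 1 * (a₂ * + 1) + v * (a₁ * + 1) * + 1 ≡ u * a₂ + v * a₁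
  unfolded = solve-∀

neg-entry₂₁ : ∀ c₂ a₁ a₂ → - (a₁ - c₂ * a₂) ≡ c₂ * a₂ + - + 1 * a₁
neg-entry₂₁ = solve-∀

lemma6 : (c0 c1 c2 : ℤ) → Irreducible (cubic c0 c1 c2) →
    Σ ℕ λ d → Σ (ℕ → ℤ) λ q →
      ∀ a0 a1 a2 →
        let M = Mα c0 c1 c2 a0 a1 a2 in
        cofactor M (suc zero) (suc (suc zero)) * cofactor M zero zero
          - cofactor M zero (suc (suc zero)) * cofactor M (suc zero) zero
          ≡ homog d q a1 a2 * det3 M
lemma6 c0 c1 c2 _ = 1 , linearForm c2 (- + 1) , λ a0 a1 a2 →
  let M = Mα c0 c1 c2 a0 a1 a2 in
  begin
    cofactor M i1 i2 * cofactor M i0 i0 - cofactor M i0 i2 * cofactor M i1 i0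
      ≡⟨ adjugate-minor M ⟩
    - (a1 - c2 * a2) * det3 M
      ≡⟨ cong (_* det3 M) (neg-entry₂₁ c2 a1 a2) ⟩
    (c2 * a2 + - + 1 * a1) * det3 M
      ≡⟨ cong (_* det3 M) (homog-linearForm c2 (- + 1) a1 a2) ⟨
    homog 1 (linearForm c2 (- + 1)) a1 a2 * det3 M
  ∎
  where open ≡-Reasoning
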